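{- Let $n>4$, let $\sigma\in K_n$, and let $\pi\in K_{n-2}$ with $\pi\prec\sigma$. Then there exists $\tau\in K_{n-1}$ such that $\pi\prec\tau\prec\sigma$.
   Context: $K_n$ is the set of permutations $\sigma\in S_n$ (one-line notation $[\sigma_1,\dots,\sigma_n]$) with $|\sigma_i-\sigma_{i-1}|\neq1$ for all $2\le i\le n$. For permutations $\pi,\sigma$, $\pi\preceq\sigma$ means some subsequence of $\sigma$ is order-isomorphic to $\pi$; $\pi\prec\sigma$ means $\pi\preceq\sigma$ and $\pi\neq\sigma$. -}

module Defs where

open import Data.Nat using (ℕ; suc)
open import Data.Fin using (Fin; toℕ; inject₁) renaming (suc to fsuc; _<_ to _<ᶠ_)
open import Data.Fin.Permutation using (Permutation′; _⟨$⟩ʳ_)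
open import Data.Product using (Σ; _×_)
open import Data.Sum using (_⊎_)
open import Relation.Binary.PropositionalEquality using (_≡_)
open import Relation.Nullary using (¬_)
open import Function.Bundles using (_⇔_)

-- A permutation σ ∈ S_n; its one-line notation is σ₁ … σₙ with σ_i = σ ⟨$⟩ʳ i
-- (positions and values are 0-indexed elements of Fin n).
Perm : ℕ → Set
Perm n = Permutation′ n

AdjVal : ∀ {n} → Fin n → Fin n → Set
AdjVal a b = (suc (toℕ a) ≡ toℕ b) ⊎ (suc (toℕ b) ≡ toℕ a)

InK : ∀ n → Perm n → Set
InK ℕ.zero σ = Data.Unit.⊤ where import Data.Unit
InK (suc m) σ = ∀ (i : Fin m) → ¬ AdjVal (σ ⟨$⟩ʳ inject₁ i) (σ ⟨$⟩ʳ fsuc i)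

_⪯_ : ∀ {k m} → Perm k → Perm m → Set
_⪯_ {k} {m} π σ =
  Σ (Fin k → Fin m) λ f →
    (∀ i j → i <ᶠ j → f i <ᶠ f j) ×
    (∀ i j → ((π ⟨$⟩ʳ i) <ᶠ (π ⟨$⟩ʳ j)) ⇔ ((σ ⟨$⟩ʳ f i) <ᶠ (σ ⟨$⟩ʳ f j)))

_≈ₚ_ : ∀ {k m} → Perm k → Perm m → Set
_≈ₚ_ {k} {m} π σ =
  Σ (k ≡ m) λ { _≡_.refl → ∀ i → (π ⟨$⟩ʳ i) ≡ (σ ⟨$⟩ʳ i) }

_≺_ : ∀ {k m} → Perm k → Perm m → Set
π ≺ σ = (π ⪯ σ) × ¬ (π ≈ₚ σ)

-- Write π as σ with the entries at two positions a and b (the holes) deleted.  Deleting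
-- the entry at one hole gives τ with π ≺ τ ≺ σ, and τ fails to lie in K only if the
-- deletion creates an adjacency: either the two positional neighbours of the hole have
-- adjacent values, or the two entries with values next to it sit at adjacent positions.
-- Unless the other hole is one of these two entries, both survive in π, where they are
-- adjacent in position and in value, contradicting π ∈ K.  So if no hole can be deleted
-- the holes are adjacent in position or in value, and then the obstruction exhibits an
-- entry that is indistinguishable from a hole relative to π: the holes can be moved one
-- step left (adjacent in position) or one step up in value (adjacent in value).  Such a
-- walk cannot go on forever.

module Submission where

open import Data.Empty using (⊥; ⊥-elim)
open import Data.Fin using (Fin; toℕ; inject₁; punchIn; punchOut; fromℕ<)
  renaming (zero to fzero; suc to fsuc; _<_ to _<ᶠ_)
import Data.Fin.Properties as F
open import Data.Fin.Permutation using (_⟨$⟩ʳ_; _⟨$⟩ˡ_; inverseʳ; remove; punchIn-permute)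
open import Data.Nat using (ℕ; zero; suc; _+_; _≤_; _<_; _∸_; s≤s)
import Data.Nat.Properties as N
open import Data.Product using (Σ; ∃; _×_; _,_; proj₁; proj₂)
open import Data.Sum using (_⊎_; inj₁; inj₂; [_,_]′)
open import Function using (_∘_; id)
open import Function.Bundles using (_⇔_; mk⇔; Equivalence; Injection)
open import Function.Definitions using (Injective)
open import Function.Properties.Inverse using (↔⇒↣)
open import Function.Construct.Composition using (_⇔-∘_)
open import Function.Construct.Identity using (⇔-id)
open import Function.Construct.Symmetry using (⇔-sym)
open import Relation.Binary.Definitions using (tri<; tri≈; tri>)
open import Relation.Binary.PropositionalEquality using (_≡_; _≢_; refl; sym; trans; cong; subst; subst₂)
open import Relation.Nullary using (¬_; Dec; yes; no; ¬?)
open import Relation.Nullary.Decidable using (decidable-stable)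

open import Defs

_⋖_ : ∀ {n} → Fin n → Fin n → Set
a ⋖ b = suc (toℕ a) ≡ toℕ b

Consecutive : ∀ {n} → Fin n → Fin n → Fin n → Set
Consecutive x y z = (x ⋖ y × y ⋖ z) ⊎ (z ⋖ y × y ⋖ x)

Between : ∀ {n} → Fin n → Fin n → Fin n → Set
Between x y z = (x <ᶠ y × y <ᶠ z) ⊎ (z <ᶠ y × y <ᶠ x)

module _ {n : ℕ} where

  ⋖⇒< : {a b : Fin n} → a ⋖ b → a <ᶠ b
  ⋖⇒< = N.≤-reflexive

  ⋖⇒≢ : {a b : Fin n} → a ⋖ b → a ≢ b
  ⋖⇒≢ = F.<⇒≢ ∘ ⋖⇒<

  ⋖-functional : {a b c : Fin n} → a ⋖ b → a ⋖ c → b ≡ c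
  ⋖-functional a⋖b a⋖c = F.toℕ-injective (trans (sym a⋖b) a⋖c)

  ⋖-¬between : {a b c : Fin n} → a ⋖ b → a <ᶠ c → c <ᶠ b → ⊥
  ⋖-¬between {c = c} a⋖b a<c c<b = N.<⇒≱ a<c (N.≤-pred (subst (λ t → suc (toℕ c) ≤ t) (sym a⋖b) c<b))

  AdjVal-sym : {a b : Fin n} → AdjVal a b → AdjVal b a
  AdjVal-sym (inj₁ e) = inj₂ e
  AdjVal-sym (inj₂ e) = inj₁ e

  AdjVal⇒≢ : {a b : Fin n} → AdjVal a b → a ≢ b
  AdjVal⇒≢ (inj₁ a⋖b) = ⋖⇒≢ a⋖b
  AdjVal⇒≢ (inj₂ b⋖a) = ⋖⇒≢ b⋖a ∘ sym

  Between-sym : {x y z : Fin n} → Between x y z → Between z y x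
  Between-sym (inj₁ p) = inj₂ p
  Between-sym (inj₂ p) = inj₁ p

  AdjVal-¬Between : {a b c : Fin n} → AdjVal a b → ¬ Between a c b
  AdjVal-¬Between (inj₁ a⋖b) (inj₁ (a<c , c<b)) = ⋖-¬between a⋖b a<c c<b
  AdjVal-¬Between (inj₁ a⋖b) (inj₂ (b<c , c<a)) = F.<-asym (⋖⇒< a⋖b) (F.<-trans b<c c<a)
  AdjVal-¬Between (inj₂ b⋖a) (inj₁ (a<c , c<b)) = F.<-asym (⋖⇒< b⋖a) (F.<-trans a<c c<b)
  AdjVal-¬Between (inj₂ b⋖a) (inj₂ (b<c , c<a)) = ⋖-¬between b⋖a b<c c<a

  Consecutive⇒AdjVal : {x y z : Fin n} → Consecutive x y z → AdjVal y x × AdjVal y z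
  Consecutive⇒AdjVal (inj₁ (x⋖y , y⋖z)) = inj₂ x⋖y , inj₁ y⋖z
  Consecutive⇒AdjVal (inj₂ (z⋖y , y⋖x)) = inj₁ y⋖x , inj₂ z⋖y

  ⋖⋖-Between-unique : {x y z w : Fin n} → x ⋖ y → y ⋖ z → Between x w z → w ≡ y
  ⋖⋖-Between-unique {w = w} x⋖y y⋖z (inj₁ (x<w , w<z)) =
    F.toℕ-injective (N.≤-antisym (N.≤-pred (subst (λ t → suc (toℕ w) ≤ t) (sym y⋖z) w<z))
                                 (subst (λ t → t ≤ toℕ w) x⋖y x<w))
  ⋖⋖-Between-unique x⋖y y⋖z (inj₂ (z<w , w<x)) =
    ⊥-elim (F.<-asym (F.<-trans z<w w<x) (F.<-trans (⋖⇒< x⋖y) (⋖⇒< y⋖z)))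

  Consecutive⇒Between-unique : {x y z w : Fin n} → Consecutive x y z → Between x w z → w ≡ y
  Consecutive⇒Between-unique (inj₁ (x⋖y , y⋖z)) = ⋖⋖-Between-unique x⋖y y⋖z
  Consecutive⇒Between-unique (inj₂ (z⋖y , y⋖x)) = ⋖⋖-Between-unique z⋖y y⋖x ∘ Between-sym

  sameSide-< : {x y z : Fin n} → y ≢ z → ¬ Between y z x → x <ᶠ z → y <ᶠ z
  sameSide-< {x} {y} {z} y≢z z∉yx x<z with F.<-cmp y z
  ... | tri< y<z _ _ = y<z
  ... | tri≈ _ y≡z _ = ⊥-elim (y≢z y≡z)
  ... | tri> _ _ z<y = ⊥-elim (z∉yx (inj₂ (x<z , z<y)))

  sameSide-> : {x y z : Fin n} → y ≢ z → ¬ Between y z x → z <ᶠ x → z <ᶠ y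
  sameSide-> {x} {y} {z} y≢z z∉yx z<x with F.<-cmp y z
  ... | tri< y<z _ _ = ⊥-elim (z∉yx (inj₁ (y<z , z<x)))
  ... | tri≈ _ y≡z _ = ⊥-elim (y≢z y≡z)
  ... | tri> _ _ z<y = z<y

  <∧¬⋖⇒∃between : {a b : Fin n} → a <ᶠ b → ¬ a ⋖ b → ∃ λ c → a <ᶠ c × c <ᶠ b
  <∧¬⋖⇒∃between {a} {b} a<b ¬a⋖b = c , N.≤-reflexive (sym toℕc) , subst (_< toℕ b) (sym toℕc) 1+a<b
    where
    1+a<b : suc (toℕ a) < toℕ b
    1+a<b = N.≤∧≢⇒< a<b ¬a⋖b
    c : Fin n
    c = fromℕ< (N.<-trans 1+a<b (F.toℕ<n b))
    toℕc : toℕ c ≡ suc (toℕ a)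
    toℕc = F.toℕ-fromℕ< _

module _ {n : ℕ} (i : Fin (suc n)) where

  punchIn-mono-< : {j k : Fin n} → j <ᶠ k → punchIn i j <ᶠ punchIn i k
  punchIn-mono-< {j} {k} j<k =
    F.≤∧≢⇒< (F.punchIn-mono-≤ i j k (N.<⇒≤ j<k)) (F.<⇒≢ j<k ∘ F.punchIn-injective i j k)

  punchIn-cancel-< : {j k : Fin n} → punchIn i j <ᶠ punchIn i k → j <ᶠ k
  punchIn-cancel-< {j} {k} lt =
    F.≤∧≢⇒< (F.punchIn-cancel-≤ i j k (N.<⇒≤ lt)) (F.<⇒≢ lt ∘ cong (punchIn i))

punchIn-⋖ : ∀ {n} (i : Fin (suc n)) {j k : Fin n} → j ⋖ k →
            punchIn i j ⋖ punchIn i k ⊎ (punchIn i j ⋖ i × i ⋖ punchIn i k)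
punchIn-⋖ fzero j⋖k = inj₁ (cong suc j⋖k)
punchIn-⋖ (fsuc fzero) {fzero} {fsuc fzero} refl = inj₂ (refl , refl)
punchIn-⋖ (fsuc (fsuc i)) {fzero} {fsuc fzero} refl = inj₁ refl
punchIn-⋖ (fsuc i) {fzero} {fsuc (fsuc k)} ()
punchIn-⋖ (fsuc i) {fsuc j} {fsuc k} j⋖k with punchIn-⋖ i (N.suc-injective j⋖k)
... | inj₁ e = inj₁ (cong suc e)
... | inj₂ (e₁ , e₂) = inj₂ (cong suc e₁ , cong suc e₂)

punchIn-AdjVal : ∀ {n} (i : Fin (suc n)) {j k : Fin n} → AdjVal j k →
                 AdjVal (punchIn i j) (punchIn i k) ⊎ Consecutive (punchIn i j) i (punchIn i k)
punchIn-AdjVal i (inj₁ j⋖k) with punchIn-⋖ i j⋖k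
... | inj₁ e = inj₁ (inj₁ e)
... | inj₂ e = inj₂ (inj₁ e)
punchIn-AdjVal i (inj₂ k⋖j) with punchIn-⋖ i k⋖j
... | inj₁ e = inj₁ (inj₂ e)
... | inj₂ e = inj₂ (inj₂ e)

module _ {m n : ℕ} {f : Fin m → Fin n} (f-mono : ∀ i j → i <ᶠ j → f i <ᶠ f j) where

  strictMono⇒reflects-< : ∀ i j → f i <ᶠ f j → i <ᶠ j
  strictMono⇒reflects-< i j fi<fj with F.<-cmp i j
  ... | tri< i<j _ _ = i<j
  ... | tri≈ _ refl _ = ⊥-elim (F.<-irrefl refl fi<fj)
  ... | tri> _ _ j<i = ⊥-elim (F.<-asym fi<fj (f-mono j i j<i))

  strictMono⇒injective : Injective _≡_ _≡_ f
  strictMono⇒injective {i} {j} fi≡fj with F.<-cmp i j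
  ... | tri< i<j _ _ = ⊥-elim (F.<⇒≢ (f-mono i j i<j) fi≡fj)
  ... | tri≈ _ i≡j _ = i≡j
  ... | tri> _ _ j<i = ⊥-elim (F.<⇒≢ (f-mono j i j<i) (sym fi≡fj))

permutation-injective : ∀ {n} (ρ : Perm n) → Injective _≡_ _≡_ (ρ ⟨$⟩ʳ_)
permutation-injective ρ = Injection.injective (↔⇒↣ ρ)

sizes-differ : ∀ {m} {ρ : Perm m} {ρ′ : Perm (suc m)} → ¬ (ρ ≈ₚ ρ′)
sizes-differ (m≡1+m , _) = N.1+n≢n (sym m≡1+m)

InK⇒¬AdjVal : ∀ {n} (ρ : Perm n) → InK n ρ → ∀ {p q} → p ⋖ q → ¬ AdjVal (ρ ⟨$⟩ʳ p) (ρ ⟨$⟩ʳ q)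
InK⇒¬AdjVal {suc n} ρ ρ∈K {p} {fsuc i} p⋖q =
  subst (λ x → ¬ AdjVal (ρ ⟨$⟩ʳ x) (ρ ⟨$⟩ʳ fsuc i)) (sym p≡i) (ρ∈K i)
  where
  p≡i : p ≡ inject₁ i
  p≡i = F.toℕ-injective (trans (N.suc-injective p⋖q) (sym (F.toℕ-inject₁ i)))

AdjVal? : ∀ {n} (a b : Fin n) → Dec (AdjVal a b)
AdjVal? a b with suc (toℕ a) N.≟ toℕ b | suc (toℕ b) N.≟ toℕ a
... | yes a⋖b | _ = yes (inj₁ a⋖b)
... | no _ | yes b⋖a = yes (inj₂ b⋖a)
... | no a⋪b | no b⋪a = no λ { (inj₁ a⋖b) → a⋪b a⋖b ; (inj₂ b⋖a) → b⋪a b⋖a }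

Avoids : ∀ {m n} → (Fin m → Fin n) → Fin n → Set
Avoids f p = ∀ j → f j ≢ p

missedPoint : ∀ {m n} → m < n → (f : Fin m → Fin n) → ∃ (Avoids f)
missedPoint m<n f with F.any? (λ p → ¬? (F.any? (λ j → f j F.≟ p)))
... | yes (p , unhit) = p , λ j fj≡p → unhit (j , fj≡p)
... | no ¬missed = ⊥-elim (F.<⇒notInjective m<n preimage-injective)
  where
  preimage : ∀ p → ∃ λ j → f j ≡ p
  preimage p = decidable-stable (F.any? (λ j → f j F.≟ p)) (λ unhit → ¬missed (p , unhit))
  preimage-injective : Injective _≡_ _≡_ (proj₁ ∘ preimage)
  preimage-injective {p} {q} e = trans (sym (proj₂ (preimage p))) (trans (cong f e) (proj₂ (preimage q)))

module _ {m n : ℕ} {f : Fin m → Fin (suc n)} {a : Fin (suc n)} (f∌a : Avoids f a) where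

  squeeze : Fin m → Fin n
  squeeze j = punchOut (f∌a j ∘ sym)

  punchIn-squeeze : ∀ j → punchIn a (squeeze j) ≡ f j
  punchIn-squeeze j = F.punchIn-punchOut _

  squeeze-injective : Injective _≡_ _≡_ f → Injective _≡_ _≡_ squeeze
  squeeze-injective f-inj e = f-inj (F.punchOut-injective (f∌a _ ∘ sym) (f∌a _ ∘ sym) e)

  squeeze-avoids : ∀ {p} → Avoids f p → (a≢p : a ≢ p) → Avoids squeeze (punchOut a≢p)
  squeeze-avoids f∌p a≢p j e = f∌p j (F.punchOut-injective (f∌a j ∘ sym) a≢p e)

record MissesExactly {m n} (f : Fin m → Fin n) (a b : Fin n) : Set where
  field
    a≢b      : a ≢ b
    avoids-a : Avoids f a
    avoids-b : Avoids f b
    covers   : ∀ p → p ≢ a → p ≢ b → ∃ λ j → f j ≡ p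

MissesExactly-swap : ∀ {m n} {f : Fin m → Fin n} {a b} → MissesExactly f a b → MissesExactly f b a
MissesExactly-swap f-misses = record
  { a≢b = a≢b ∘ sym ; avoids-a = avoids-b ; avoids-b = avoids-a ; covers = λ p p≢b p≢a → covers p p≢a p≢b }
  where open MissesExactly f-misses

twoHoles : ∀ {k} (f : Fin (suc k) → Fin (suc (suc (suc k)))) → Injective _≡_ _≡_ f →
           ∃ λ a → ∃ λ b → MissesExactly f a b
twoHoles {k} f f-injective with missedPoint (N.<-trans (N.n<1+n _) (N.n<1+n _)) f
... | a , f∌a with missedPoint (N.n<1+n (suc k)) (squeeze f∌a)
...   | b′ , f′∌b′ = a , punchIn a b′ , record
  { a≢b = F.punchInᵢ≢i a b′ ∘ sym ; avoids-a = f∌a ; avoids-b = f∌b ; covers = onto }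
  where
  f∌b : Avoids f (punchIn a b′)
  f∌b j e = f′∌b′ j (F.punchIn-injective a _ _ (trans (punchIn-squeeze f∌a j) e))
  onto : ∀ p → p ≢ a → p ≢ punchIn a b′ → ∃ λ j → f j ≡ p
  onto p p≢a p≢b = decidable-stable (F.any? (λ j → f j F.≟ p)) λ unhit →
    F.<⇒notInjective (N.n<1+n k)
      (squeeze-injective (f″∌p″ unhit) (squeeze-injective f′∌b′ (squeeze-injective f∌a f-injective)))
    where
    a≢p : a ≢ p
    a≢p = p≢a ∘ sym
    b′≢p′ : b′ ≢ punchOut a≢p
    b′≢p′ e = p≢b (trans (sym (F.punchIn-punchOut a≢p)) (cong (punchIn a) (sym e)))
    f″∌p″ : ¬ (∃ λ j → f j ≡ p) → Avoids (squeeze f′∌b′) (punchOut b′≢p′)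
    f″∌p″ unhit = squeeze-avoids f′∌b′ (squeeze-avoids f∌a (λ j e → unhit (j , e)) a≢p) b′≢p′

module Deletion {m : ℕ} (σ : Perm (suc m)) (c : Fin (suc m)) where

  remove-<-⇔ : ∀ i j → ((remove c σ ⟨$⟩ʳ i) <ᶠ (remove c σ ⟨$⟩ʳ j)) ⇔
                       ((σ ⟨$⟩ʳ punchIn c i) <ᶠ (σ ⟨$⟩ʳ punchIn c j))
  remove-<-⇔ i j = subst₂ (λ x y → ((remove c σ ⟨$⟩ʳ i) <ᶠ (remove c σ ⟨$⟩ʳ j)) ⇔ (x <ᶠ y))
                     (sym (punchIn-permute σ c i)) (sym (punchIn-permute σ c j))
                     (mk⇔ (punchIn-mono-< (σ ⟨$⟩ʳ c)) (punchIn-cancel-< (σ ⟨$⟩ʳ c)))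

  remove-⪯ : remove c σ ⪯ σ
  remove-⪯ = punchIn c , (λ _ _ → punchIn-mono-< c) , remove-<-⇔

  ⪯-remove : ∀ {k} {π : Perm k} (occ : π ⪯ σ) → Avoids (proj₁ occ) c → π ⪯ remove c σ
  ⪯-remove {π = π} (g , g-mono , g-iso) g∌c = squeeze g∌c , mono , iso
    where
    g≡ : ∀ j → punchIn c (squeeze g∌c j) ≡ g j
    g≡ = punchIn-squeeze g∌c
    mono : ∀ i j → i <ᶠ j → squeeze g∌c i <ᶠ squeeze g∌c j
    mono i j i<j = punchIn-cancel-< c (subst₂ _<ᶠ_ (sym (g≡ i)) (sym (g≡ j)) (g-mono i j i<j))
    iso : ∀ i j → ((π ⟨$⟩ʳ i) <ᶠ (π ⟨$⟩ʳ j)) ⇔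
                  ((remove c σ ⟨$⟩ʳ squeeze g∌c i) <ᶠ (remove c σ ⟨$⟩ʳ squeeze g∌c j))
    iso i j = ⇔-sym (remove-<-⇔ _ _) ⇔-∘
              subst₂ (λ x y → ((π ⟨$⟩ʳ i) <ᶠ (π ⟨$⟩ʳ j)) ⇔ ((σ ⟨$⟩ʳ x) <ᶠ (σ ⟨$⟩ʳ y)))
                     (sym (g≡ i)) (sym (g≡ j)) (g-iso i j)

module Obstructions {m : ℕ} (σ : Perm (suc (suc m))) (σ∈K : InK (suc (suc m)) σ) where

  data Obstruction (c : Fin (suc (suc m))) : Set where
    positionNeighbours : ∀ {p q} → p ⋖ c → c ⋖ q → AdjVal (σ ⟨$⟩ʳ p) (σ ⟨$⟩ʳ q) → Obstruction c
    valueNeighbours    : ∀ {p q} → p ⋖ q → Consecutive (σ ⟨$⟩ʳ p) (σ ⟨$⟩ʳ c) (σ ⟨$⟩ʳ q) →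
                         Obstruction c

  remove-InK⊎Obstruction : ∀ c → InK (suc m) (remove c σ) ⊎ Obstruction c
  remove-InK⊎Obstruction c
    with F.any? (λ i → AdjVal? (remove c σ ⟨$⟩ʳ inject₁ i) (remove c σ ⟨$⟩ʳ fsuc i))
  ... | no ¬adj = inj₁ (λ i adj → ¬adj (i , adj))
  ... | yes (i , adj) = inj₂ (obstruction (punchIn-⋖ c inject₁⋖fsuc) valueCase)
    where
    P Q : Fin (suc (suc m))
    P = punchIn c (inject₁ i)
    Q = punchIn c (fsuc i)
    inject₁⋖fsuc : inject₁ i ⋖ fsuc i
    inject₁⋖fsuc = cong suc (F.toℕ-inject₁ i)
    valueCase : AdjVal (σ ⟨$⟩ʳ P) (σ ⟨$⟩ʳ Q) ⊎ Consecutive (σ ⟨$⟩ʳ P) (σ ⟨$⟩ʳ c) (σ ⟨$⟩ʳ Q)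
    valueCase = subst₂ (λ x y → AdjVal x y ⊎ Consecutive x (σ ⟨$⟩ʳ c) y)
                  (sym (punchIn-permute σ c (inject₁ i))) (sym (punchIn-permute σ c (fsuc i)))
                  (punchIn-AdjVal (σ ⟨$⟩ʳ c) adj)
    obstruction : P ⋖ Q ⊎ (P ⋖ c × c ⋖ Q) →
                  AdjVal (σ ⟨$⟩ʳ P) (σ ⟨$⟩ʳ Q) ⊎ Consecutive (σ ⟨$⟩ʳ P) (σ ⟨$⟩ʳ c) (σ ⟨$⟩ʳ Q) →
                  Obstruction c
    obstruction (inj₁ P⋖Q) (inj₁ adjPQ) = ⊥-elim (InK⇒¬AdjVal σ σ∈K P⋖Q adjPQ)
    obstruction (inj₁ P⋖Q) (inj₂ consecutive) = valueNeighbours P⋖Q consecutive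
    obstruction (inj₂ (P⋖c , c⋖Q)) (inj₁ adjPQ) = positionNeighbours P⋖c c⋖Q adjPQ
    obstruction (inj₂ (P⋖c , _)) (inj₂ consecutive) =
      ⊥-elim (InK⇒¬AdjVal σ σ∈K P⋖c (AdjVal-sym (proj₁ (Consecutive⇒AdjVal consecutive))))

module Holes {k : ℕ} (σ : Perm (suc (suc k))) (π : Perm k) (π∈K : InK k π) where

  record HoledOccurrence (a b : Fin (suc (suc k))) : Set where
    field
      g        : Fin k → Fin (suc (suc k))
      g-mono   : ∀ i j → i <ᶠ j → g i <ᶠ g j
      g-iso    : ∀ i j → ((π ⟨$⟩ʳ i) <ᶠ (π ⟨$⟩ʳ j)) ⇔ ((σ ⟨$⟩ʳ g i) <ᶠ (σ ⟨$⟩ʳ g j))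
      g-misses : MissesExactly g a b

    open MissesExactly g-misses public

    occurrence : π ⪯ σ
    occurrence = g , g-mono , g-iso

    Hole : Fin (suc (suc k)) → Set
    Hole w = w ≡ a ⊎ w ≡ b

    g-¬Hole : ∀ j → ¬ Hole (g j)
    g-¬Hole j = [ avoids-a j , avoids-b j ]′

  swapHoles : ∀ {a b} → HoledOccurrence a b → HoledOccurrence b a
  swapHoles h = record
    { g = g ; g-mono = g-mono ; g-iso = g-iso ; g-misses = MissesExactly-swap g-misses }
    where open HoledOccurrence h

  module _ {a b} (h : HoledOccurrence a b) where
    open HoledOccurrence h

    private
      preimages-⋖ : ∀ {j j'} → g j <ᶠ g j' → (∀ w → g j <ᶠ w → w <ᶠ g j' → Hole w) → j ⋖ j'
      preimages-⋖ {j} {j'} gj<gj' only-holes with suc (toℕ j) N.≟ toℕ j'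
      ... | yes j⋖j' = j⋖j'
      ... | no ¬j⋖j' with <∧¬⋖⇒∃between (strictMono⇒reflects-< g-mono j j' gj<gj') ¬j⋖j'
      ...   | i , j<i , i<j' = ⊥-elim (g-¬Hole i (only-holes (g i) (g-mono j i j<i) (g-mono i j' i<j')))

      values-⋖ : ∀ {j j'} → (π ⟨$⟩ʳ j) <ᶠ (π ⟨$⟩ʳ j') →
                 (∀ w → Between (σ ⟨$⟩ʳ g j) (σ ⟨$⟩ʳ w) (σ ⟨$⟩ʳ g j') → Hole w) →
                 (π ⟨$⟩ʳ j) ⋖ (π ⟨$⟩ʳ j')
      values-⋖ {j} {j'} πj<πj' only-holes with suc (toℕ (π ⟨$⟩ʳ j)) N.≟ toℕ (π ⟨$⟩ʳ j')
      ... | yes πj⋖πj' = πj⋖πj'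
      ... | no ¬πj⋖πj' with <∧¬⋖⇒∃between πj<πj' ¬πj⋖πj'
      ...   | z , πj<z , z<πj' = ⊥-elim (g-¬Hole i (only-holes (g i)
                (inj₁ (Equivalence.to (g-iso j i) (subst (_ <ᶠ_) (sym πi≡z) πj<z) ,
                       Equivalence.to (g-iso i j') (subst (_<ᶠ _) (sym πi≡z) z<πj')))))
        where
        i : Fin k
        i = π ⟨$⟩ˡ z
        πi≡z : π ⟨$⟩ʳ i ≡ z
        πi≡z = inverseʳ π

      values-AdjVal : ∀ {j j'} → j ≢ j' →
                      (∀ w → Between (σ ⟨$⟩ʳ g j) (σ ⟨$⟩ʳ w) (σ ⟨$⟩ʳ g j') → Hole w) →
                      AdjVal (π ⟨$⟩ʳ j) (π ⟨$⟩ʳ j')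
      values-AdjVal {j} {j'} j≢j' only-holes with F.<-cmp (π ⟨$⟩ʳ j) (π ⟨$⟩ʳ j')
      ... | tri< πj<πj' _ _ = inj₁ (values-⋖ πj<πj' only-holes)
      ... | tri≈ _ πj≡πj' _ = ⊥-elim (j≢j' (permutation-injective π πj≡πj'))
      ... | tri> _ _ πj'<πj = inj₂ (values-⋖ πj'<πj (λ w → only-holes w ∘ Between-sym))

    noAdjacencyAcrossHoles : ∀ {u v} → ¬ Hole u → ¬ Hole v → u <ᶠ v →
                             (∀ w → u <ᶠ w → w <ᶠ v → Hole w) →
                             (∀ w → Between (σ ⟨$⟩ʳ u) (σ ⟨$⟩ʳ w) (σ ⟨$⟩ʳ v) → Hole w) → ⊥
    noAdjacencyAcrossHoles {u} {v} u∉ v∉ u<v positions values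
      with covers u (u∉ ∘ inj₁) (u∉ ∘ inj₂) | covers v (v∉ ∘ inj₁) (v∉ ∘ inj₂)
    ... | j , refl | j' , refl =
      InK⇒¬AdjVal π π∈K (preimages-⋖ u<v positions) (values-AdjVal (λ { refl → F.<-irrefl refl u<v }) values)

    positionNeighbours⇒otherHole : ∀ {p q} → p ⋖ a → a ⋖ q → AdjVal (σ ⟨$⟩ʳ p) (σ ⟨$⟩ʳ q) →
                                   p ≡ b ⊎ q ≡ b
    positionNeighbours⇒otherHole {p} {q} p⋖a a⋖q adj with p F.≟ b | q F.≟ b
    ... | yes p≡b | _ = inj₁ p≡b
    ... | no _ | yes q≡b = inj₂ q≡b
    ... | no p≢b | no q≢b = ⊥-elim (noAdjacencyAcrossHoles
          [ ⋖⇒≢ p⋖a , p≢b ]′ [ ⋖⇒≢ a⋖q ∘ sym , q≢b ]′ (F.<-trans (⋖⇒< p⋖a) (⋖⇒< a⋖q))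
          (λ w p<w w<q → inj₁ (⋖⋖-Between-unique p⋖a a⋖q (inj₁ (p<w , w<q))))
          (λ w → ⊥-elim ∘ AdjVal-¬Between adj))

    valueNeighbours⇒otherHole : ∀ {p q} → p ⋖ q → Consecutive (σ ⟨$⟩ʳ p) (σ ⟨$⟩ʳ a) (σ ⟨$⟩ʳ q) →
                                p ≡ b ⊎ q ≡ b
    valueNeighbours⇒otherHole {p} {q} p⋖q consecutive with p F.≟ b | q F.≟ b
    ... | yes p≡b | _ = inj₁ p≡b
    ... | no _ | yes q≡b = inj₂ q≡b
    ... | no p≢b | no q≢b = ⊥-elim (noAdjacencyAcrossHoles
          [ AdjVal⇒≢ σa~σp ∘ cong (σ ⟨$⟩ʳ_) ∘ sym , p≢b ]′
          [ AdjVal⇒≢ σa~σq ∘ cong (σ ⟨$⟩ʳ_) ∘ sym , q≢b ]′ (⋖⇒< p⋖q)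
          (λ w p<w w<q → ⊥-elim (⋖-¬between p⋖q p<w w<q))
          (λ w → inj₁ ∘ permutation-injective σ ∘ Consecutive⇒Between-unique consecutive))
      where
      σa~σp : AdjVal (σ ⟨$⟩ʳ a) (σ ⟨$⟩ʳ p)
      σa~σp = proj₁ (Consecutive⇒AdjVal consecutive)
      σa~σq : AdjVal (σ ⟨$⟩ʳ a) (σ ⟨$⟩ʳ q)
      σa~σq = proj₂ (Consecutive⇒AdjVal consecutive)

  module _ {a b c} (h : HoledOccurrence a b) (c≢a : c ≢ a) (c≢b : c ≢ b) where
    open HoledOccurrence h

    private
      relabel : Fin (suc (suc k)) → Fin (suc (suc k))
      relabel x with x F.≟ c
      ... | yes _ = b
      ... | no _ = x

      relabel-cases : ∀ x → (x ≡ c × relabel x ≡ b) ⊎ (x ≢ c × relabel x ≡ x)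
      relabel-cases x with x F.≟ c
      ... | yes x≡c = inj₁ (x≡c , refl)
      ... | no x≢c = inj₂ (x≢c , refl)

      module _ (ι : Fin (suc (suc k)) → Fin (suc (suc k))) (ι-injective : Injective _≡_ _≡_ ι)
               (only-a : ∀ w → Between (ι b) (ι w) (ι c) → w ≡ a) where

        sameSides : ∀ {x} → ¬ Hole x → x ≢ c →
                    ((ι c <ᶠ ι x) ⇔ (ι b <ᶠ ι x)) × ((ι x <ᶠ ι c) ⇔ (ι x <ᶠ ι b))
        sameSides {x} x∉ x≢c =
          mk⇔ (sameSide-< ιb≢ιx x∉bc) (sameSide-< ιc≢ιx (x∉bc ∘ Between-sym)) ,
          mk⇔ (sameSide-> ιb≢ιx x∉bc) (sameSide-> ιc≢ιx (x∉bc ∘ Between-sym))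
          where
          ιb≢ιx : ι b ≢ ι x
          ιb≢ιx e = x∉ (inj₂ (sym (ι-injective e)))
          ιc≢ιx : ι c ≢ ι x
          ιc≢ιx e = x≢c (sym (ι-injective e))
          x∉bc : ¬ Between (ι b) (ι x) (ι c)
          x∉bc = x∉ ∘ inj₁ ∘ only-a x

        relabel-<-⇔ : ∀ i j → (ι (g i) <ᶠ ι (g j)) ⇔ (ι (relabel (g i)) <ᶠ ι (relabel (g j)))
        relabel-<-⇔ i j with relabel-cases (g i) | relabel-cases (g j)
        ... | inj₁ (gi≡c , ri) | inj₁ (gj≡c , rj) rewrite ri | rj =
          mk⇔ (⊥-elim ∘ F.<-irrefl (cong ι (trans gi≡c (sym gj≡c)))) (⊥-elim ∘ F.<-irrefl refl)
        ... | inj₁ (gi≡c , ri) | inj₂ (gj≢c , rj) rewrite ri | rj | gi≡c = proj₁ (sameSides (g-¬Hole j) gj≢c)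
        ... | inj₂ (gi≢c , ri) | inj₁ (gj≡c , rj) rewrite ri | rj | gj≡c = proj₂ (sameSides (g-¬Hole i) gi≢c)
        ... | inj₂ (_ , ri) | inj₂ (_ , rj) rewrite ri | rj = ⇔-id _

    -- No entry of the occurrence lies between b and c, in position or in value, so c can
    -- take over the role of b.
    moveHole : (∀ w → Between b w c → w ≡ a) →
               (∀ w → Between (σ ⟨$⟩ʳ b) (σ ⟨$⟩ʳ w) (σ ⟨$⟩ʳ c) → w ≡ a) → HoledOccurrence a c
    moveHole positions values = record
      { g        = relabel ∘ g
      ; g-mono   = λ i j i<j → Equivalence.to (relabel-<-⇔ id id positions i j) (g-mono i j i<j)
      ; g-iso    = λ i j → relabel-<-⇔ (σ ⟨$⟩ʳ_) (permutation-injective σ) values i j ⇔-∘ g-iso i j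
      ; g-misses = record { a≢b = c≢a ∘ sym ; avoids-a = g∌a′ ; avoids-b = g∌c ; covers = onto } }
      where
      g∌a′ : Avoids (relabel ∘ g) a
      g∌a′ j with relabel-cases (g j)
      ... | inj₁ (_ , r) = λ e → a≢b (trans (sym e) r)
      ... | inj₂ (_ , r) = λ e → avoids-a j (trans (sym r) e)
      g∌c : Avoids (relabel ∘ g) c
      g∌c j with relabel-cases (g j)
      ... | inj₁ (_ , r) = λ e → c≢b (trans (sym e) r)
      ... | inj₂ (gj≢c , r) = λ e → gj≢c (trans (sym r) e)
      onto : ∀ p → p ≢ a → p ≢ c → ∃ λ j → relabel (g j) ≡ p
      onto p p≢a p≢c with p F.≟ b | covers c c≢a c≢b
      ... | yes refl | j , gj≡c with relabel-cases (g j)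
      ...   | inj₁ (_ , r) = j , r
      ...   | inj₂ (gj≢c , _) = ⊥-elim (gj≢c gj≡c)
      onto p p≢a p≢c | no p≢b | _ with covers p p≢a p≢b
      ...   | j , gj≡p with relabel-cases (g j)
      ...     | inj₁ (gj≡c , _) = ⊥-elim (p≢c (trans (sym gj≡p) gj≡c))
      ...     | inj₂ (_ , r) = j , trans r gj≡p

module Walk {k : ℕ} (σ : Perm (suc (suc k))) (σ∈K : InK (suc (suc k)) σ) (π : Perm k) (π∈K : InK k π) where

  open Holes σ π π∈K
  open Obstructions σ σ∈K

  GoodDeletion : Set
  GoodDeletion = ∃ λ c → InK (suc k) (remove c σ) × π ⪯ remove c σ

  deleteHole : ∀ {a b} → HoledOccurrence a b → InK (suc k) (remove a σ) → GoodDeletion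
  deleteHole {a} h remove∈K = a , remove∈K , Deletion.⪯-remove σ a {π = π} occurrence avoids-a
    where open HoledOccurrence h

  fromPositionAdjacentHoles : ∀ t {a b} → toℕ a ≡ t → a ⋖ b → HoledOccurrence a b → GoodDeletion
  fromPositionAdjacentHoles t {a} {b} a≡t a⋖b h with remove-InK⊎Obstruction a
  ... | inj₁ remove∈K = deleteHole h remove∈K
  ... | inj₂ (valueNeighbours p⋖q consecutive) with valueNeighbours⇒otherHole h p⋖q consecutive
  ...   | inj₁ refl = ⊥-elim (InK⇒¬AdjVal σ σ∈K a⋖b (proj₁ (Consecutive⇒AdjVal consecutive)))
  ...   | inj₂ refl = ⊥-elim (InK⇒¬AdjVal σ σ∈K a⋖b (proj₂ (Consecutive⇒AdjVal consecutive)))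
  fromPositionAdjacentHoles zero a≡t a⋖b h | inj₂ (positionNeighbours p⋖a a⋖q adj) =
    ⊥-elim (N.1+n≢0 (trans p⋖a a≡t))
  fromPositionAdjacentHoles (suc t) {a} {b} a≡t a⋖b h | inj₂ (positionNeighbours {p} p⋖a a⋖q adj)
    with ⋖-functional a⋖q a⋖b
  ... | refl = fromPositionAdjacentHoles t (N.suc-injective (trans p⋖a a≡t)) p⋖a
                 (swapHoles (moveHole h (⋖⇒≢ p⋖a) p≢b
                   (λ w → Consecutive⇒Between-unique (inj₂ (p⋖a , a⋖b)))
                   (λ w → ⊥-elim ∘ AdjVal-¬Between (AdjVal-sym adj))))
    where
    p≢b : p ≢ b
    p≢b p≡b = F.<-irrefl p≡b (F.<-trans (⋖⇒< p⋖a) (⋖⇒< a⋖b))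

  fromValueAdjacentHoles : ∀ t {lo hi} → toℕ (σ ⟨$⟩ʳ hi) + t ≡ suc (suc k) →
                           (σ ⟨$⟩ʳ lo) ⋖ (σ ⟨$⟩ʳ hi) → HoledOccurrence lo hi → GoodDeletion
  fromValueAdjacentHoles zero {hi = hi} σhi+0≡N _ _ =
    ⊥-elim (N.<-irrefl (trans (sym (N.+-identityʳ _)) σhi+0≡N) (F.toℕ<n (σ ⟨$⟩ʳ hi)))
  fromValueAdjacentHoles (suc t) {lo} {hi} σhi+t≡N σlo⋖σhi h with remove-InK⊎Obstruction hi
  ... | inj₁ remove∈K = deleteHole (swapHoles h) remove∈K
  ... | inj₂ (positionNeighbours p⋖hi hi⋖q adj) with positionNeighbours⇒otherHole (swapHoles h) p⋖hi hi⋖q adj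
  ...   | inj₁ refl = ⊥-elim (InK⇒¬AdjVal σ σ∈K p⋖hi (inj₁ σlo⋖σhi))
  ...   | inj₂ refl = ⊥-elim (InK⇒¬AdjVal σ σ∈K hi⋖q (inj₂ σlo⋖σhi))
  fromValueAdjacentHoles (suc t) {lo} {hi} σhi+t≡N σlo⋖σhi h | inj₂ (valueNeighbours {p} {q} p⋖q consecutive) =
    continue (valueNeighbours⇒otherHole (swapHoles h) p⋖q consecutive) consecutive
    where
    moveUp : ∀ {up} → (σ ⟨$⟩ʳ hi) ⋖ (σ ⟨$⟩ʳ up) → AdjVal lo up → GoodDeletion
    moveUp {up} σhi⋖σup lo~up = fromValueAdjacentHoles t σup+t≡N σhi⋖σup
      (moveHole (swapHoles h) up≢hi up≢lo
        (λ w → ⊥-elim ∘ AdjVal-¬Between lo~up)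
        (λ w → permutation-injective σ ∘ Consecutive⇒Between-unique (inj₁ (σlo⋖σhi , σhi⋖σup))))
      where
      σup+t≡N : toℕ (σ ⟨$⟩ʳ up) + t ≡ suc (suc k)
      σup+t≡N = trans (cong (_+ t) (sym σhi⋖σup)) (trans (sym (N.+-suc _ t)) σhi+t≡N)
      up≢hi : up ≢ hi
      up≢hi = ⋖⇒≢ σhi⋖σup ∘ sym ∘ cong (σ ⟨$⟩ʳ_)
      up≢lo : up ≢ lo
      up≢lo refl = F.<-asym (⋖⇒< σlo⋖σhi) (⋖⇒< σhi⋖σup)
    continue : p ≡ lo ⊎ q ≡ lo → Consecutive (σ ⟨$⟩ʳ p) (σ ⟨$⟩ʳ hi) (σ ⟨$⟩ʳ q) → GoodDeletion
    continue (inj₁ refl) (inj₁ (_ , σhi⋖σq)) = moveUp σhi⋖σq (inj₁ p⋖q)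
    continue (inj₁ refl) (inj₂ (_ , σhi⋖σlo)) = ⊥-elim (F.<-asym (⋖⇒< σlo⋖σhi) (⋖⇒< σhi⋖σlo))
    continue (inj₂ refl) (inj₁ (_ , σhi⋖σlo)) = ⊥-elim (F.<-asym (⋖⇒< σlo⋖σhi) (⋖⇒< σhi⋖σlo))
    continue (inj₂ refl) (inj₂ (_ , σhi⋖σp)) = moveUp σhi⋖σp (inj₂ p⋖q)

  fromPositionAdjacent : ∀ {a b} → AdjVal a b → HoledOccurrence a b → GoodDeletion
  fromPositionAdjacent (inj₁ a⋖b) h = fromPositionAdjacentHoles _ refl a⋖b h
  fromPositionAdjacent (inj₂ b⋖a) h = fromPositionAdjacentHoles _ refl b⋖a (swapHoles h)

  σ-+-∸ : ∀ x → toℕ (σ ⟨$⟩ʳ x) + (suc (suc k) ∸ toℕ (σ ⟨$⟩ʳ x)) ≡ suc (suc k)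
  σ-+-∸ x = N.m+[n∸m]≡n (N.<⇒≤ (F.toℕ<n (σ ⟨$⟩ʳ x)))

  fromValueAdjacent : ∀ {a b} → AdjVal (σ ⟨$⟩ʳ a) (σ ⟨$⟩ʳ b) → HoledOccurrence a b → GoodDeletion
  fromValueAdjacent {a} {b} (inj₁ σa⋖σb) h = fromValueAdjacentHoles _ (σ-+-∸ b) σa⋖σb h
  fromValueAdjacent {a} {b} (inj₂ σb⋖σa) h = fromValueAdjacentHoles _ (σ-+-∸ a) σb⋖σa (swapHoles h)

  fromHoles : ∀ {a b} → HoledOccurrence a b → GoodDeletion
  fromHoles {a} {b} h with AdjVal? a b
  ... | yes a~b = fromPositionAdjacent a~b h
  ... | no a≁b with remove-InK⊎Obstruction a
  ...   | inj₁ remove∈K = deleteHole h remove∈K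
  ...   | inj₂ (positionNeighbours p⋖a a⋖q adj) with positionNeighbours⇒otherHole h p⋖a a⋖q adj
  ...     | inj₁ refl = ⊥-elim (a≁b (inj₂ p⋖a))
  ...     | inj₂ refl = ⊥-elim (a≁b (inj₁ a⋖q))
  fromHoles h | no _ | inj₂ (valueNeighbours p⋖q consecutive) with valueNeighbours⇒otherHole h p⋖q consecutive
  ... | inj₁ refl = fromValueAdjacent (proj₁ (Consecutive⇒AdjVal consecutive)) h
  ... | inj₂ refl = fromValueAdjacent (proj₂ (Consecutive⇒AdjVal consecutive)) h

  ≺-between : GoodDeletion → Σ (Perm (suc k)) λ τ → InK (suc k) τ × (π ≺ τ) × (τ ≺ σ)
  ≺-between (c , remove∈K , π⪯remove) =
    remove c σ , remove∈K , (π⪯remove , sizes-differ) , (Deletion.remove-⪯ σ c , sizes-differ)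

holedOccurrence : ∀ {k} (σ : Perm (suc (suc (suc k)))) (π : Perm (suc k)) (π∈K : InK (suc k) π) →
                  π ⪯ σ → ∃ λ a → ∃ λ b → Holes.HoledOccurrence σ π π∈K a b
holedOccurrence σ π π∈K (f , f-mono , f-iso) =
  proj₁ holes , proj₁ (proj₂ holes) ,
  record { g = f ; g-mono = f-mono ; g-iso = f-iso ; g-misses = proj₂ (proj₂ holes) }
  where
  holes : ∃ λ a → ∃ λ b → MissesExactly f a b
  holes = twoHoles f (strictMono⇒injective f-mono)

mainTheorem4 : (n : ℕ) → 4 < n →
    (σ : Perm n) → InK n σ →
    (π : Perm (n ∸ 2)) → InK (n ∸ 2) π → π ≺ σ →
    Σ (Perm (n ∸ 1)) λ τ → InK (n ∸ 1) τ × (π ≺ τ) × (τ ≺ σ)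
-- The argument only needs n ≥ 3.
mainTheorem4 (suc zero) (s≤s ())
mainTheorem4 (suc (suc zero)) (s≤s (s≤s ()))
mainTheorem4 (suc (suc (suc k))) _ σ σ∈K π π∈K (π⪯σ , _) =
  ≺-between (fromHoles (proj₂ (proj₂ (holedOccurrence σ π π∈K π⪯σ))))
  where open Walk σ σ∈K π π∈K
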